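{- Let $[x,y]$ be an interval in $P(n;\epsilon)$. The $EL$-labeling for $[x,y]$ is snelling.
   Context: A network on $n$ points $1,\dots,n$ of a line is a set of directed edges $(i,j)$ with $i<j$ (at most one edge from $i$ to $j$), such that every point is a source (only outgoing edges, at least one), a sink (only incoming edges, at least one), or a neutral point (no edges); moreover it satisfies (B1): if it contains $(i,k)$ and $(j,l)$ with $i<j<k<l$, then it contains $(j,k)$. Let $\epsilon=\epsilon_1\ldots\epsilon_n\in\{1,0,-1\}^n$ whose first nonzero entry is $1$; $N(n;\epsilon)$ is the set of such networks in which point $i$ is a source or neutral if $\epsilon_i=1$, a sink or neutral if $\epsilon_i=-1$, and neutral if $\epsilon_i=0$. Write $E(x)$ for the set of directed edges of a network $x$ and $\rho(x)=|E(x)|$. The poset $P(n;\epsilon)=(N(n;\epsilon),\le)$ has covering relation: $y$ covers $x$ iff $\rho(y)=\rho(x)+1$ and $E(x)\subset E(y)$; it is a finite graded lattice with rank function $\rho$. Its edge-labeling is $\lambda(x,y)=E(y)\setminus E(x)$ (a single directed edge) for $x\lessdot y$, where directed edges are linearly ordered by $(i,j)<(k,l)$ if $j<l$, or if $j=l$ and $i>k$; this $\lambda$ is an $EL$-labeling of $P(n;\epsilon)$ (and of each interval). An $EL$-labeling of an interval $[x,y]$ of rank $m=\rho(y)-\rho(x)$ is called an $\mathcal{S}_m$ $EL$-labeling, or snelling, if for every maximal chain $x=x_0\lessdot x_1\lessdot\cdots\lessdot x_m=y$ the map $i\mapsto\lambda(x_{i-1},x_i)$ is a permutation of $[m]$ (labels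 identified with $[m]$ via the linear order on the edges). -}

module Defs where

open import Data.Nat using (ℕ; zero; suc; _+_)
open import Data.Bool using (Bool; true; false; _∧_; not)
open import Data.Fin using (Fin; _<_; _>_)
open import Data.Vec using (Vec; lookup; []; _∷_)
open import Data.List using (List; []; _∷_; _++_; map; concatMap; reverse; filterᵇ; allFin)
open import Data.Maybe using (Maybe; just; nothing)
open import Data.Product using (Σ; ∃; _×_; _,_)
open import Data.Sum using (_⊎_)
open import Relation.Nullary using (¬_)
open import Relation.Binary.PropositionalEquality using (_≡_)
open import Data.List.Relation.Binary.Lex.Core using (Lex-<)
open import Data.List.Relation.Binary.Permutation.Propositional using (_↭_)

-- Entries of ε : pos = 1, zer = 0, neg = -1.
data Sign : Set where
  pos zer neg : Sign

firstNonzero : ∀ {n} → Vec Sign n → Maybe Sign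
firstNonzero []          = nothing
firstNonzero (zer ∷ es)  = firstNonzero es
firstNonzero (pos ∷ es)  = just pos
firstNonzero (neg ∷ es)  = just neg

FirstNonzeroIsOne : ∀ {n} → Vec Sign n → Set
FirstNonzeroIsOne ε = ¬ (firstNonzero ε ≡ just neg)

-- A candidate edge set on points 0..n-1 (= 1..n of the paper):
-- x has the directed edge (i , j) iff  lookup (lookup x i) j = true.
Net : ℕ → Set
Net n = Vec (Vec Bool n) n

edgeᵇ : ∀ {n} → Net n → Fin n → Fin n → Bool
edgeᵇ x i j = lookup (lookup x i) j

HasEdge : ∀ {n} → Net n → Fin n → Fin n → Set
HasEdge x i j = edgeᵇ x i j ≡ true

IsSource IsSink IsNeutral : ∀ {n} → Net n → Fin n → Set
IsSource  x i = (∃ λ j → HasEdge x i j) × (∀ k → ¬ HasEdge x k i)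
IsSink    x i = (∃ λ k → HasEdge x k i) × (∀ j → ¬ HasEdge x i j)
IsNeutral x i = (∀ j → ¬ HasEdge x i j) × (∀ k → ¬ HasEdge x k i)

record IsNetwork {n} (x : Net n) : Set where
  field
    forward : ∀ i j → HasEdge x i j → i < j
    kind    : ∀ i → IsSource x i ⊎ IsSink x i ⊎ IsNeutral x i
    B1      : ∀ i j k l → i < j → j < k → k < l →
              HasEdge x i k → HasEdge x j l → HasEdge x j k

SignOK : ∀ {n} → Net n → Fin n → Sign → Set
SignOK x i pos = IsSource x i ⊎ IsNeutral x i
SignOK x i neg = IsSink x i ⊎ IsNeutral x i
SignOK x i zer = IsNeutral x i

InN : ∀ {n} → Vec Sign n → Net n → Set
InN ε x = IsNetwork x × (∀ i → SignOK x i (lookup ε i))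

countTrue : ∀ {m} → Vec Bool m → ℕ
countTrue []           = 0
countTrue (true  ∷ bs) = suc (countTrue bs)
countTrue (false ∷ bs) = countTrue bs

sumℕ : ∀ {m} → Vec ℕ m → ℕ
sumℕ []       = 0
sumℕ (a ∷ as) = a + sumℕ as

vmap : ∀ {A B : Set} {m} → (A → B) → Vec A m → Vec B m
vmap f []       = []
vmap f (a ∷ as) = f a ∷ vmap f as

ρ : ∀ {n} → Net n → ℕ
ρ x = sumℕ (vmap countTrue x)

_⊆E_ : ∀ {n} → Net n → Net n → Set
x ⊆E y = ∀ i j → HasEdge x i j → HasEdge y i j

Covers : ∀ {n} → Vec Sign n → Net n → Net n → Set
Covers ε x y = InN ε x × InN ε y × (ρ y ≡ suc (ρ x)) × (x ⊆E y)

Edge : ℕ → Set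
Edge n = Fin n × Fin n

data _<E_ {n} : Edge n → Edge n → Set where
  byHead : ∀ {i j k l} → j < l → (i , j) <E (k , l)
  byTail : ∀ {i j k}   → i > k → (i , j) <E (k , j)

_≤E_ : ∀ {n} → Edge n → Edge n → Set
e ≤E f = e ≡ f ⊎ e <E f

-- all pairs, listed in increasing <E order
allEdges : ∀ n → List (Edge n)
allEdges n = concatMap (λ j → map (λ i → (i , j)) (reverse (allFin n))) (allFin n)

-- E(y) \ E(x), listed in increasing order of edges
diffE : ∀ {n} → Net n → Net n → List (Edge n)
diffE {n} x y = filterᵇ (λ { (i , j) → edgeᵇ y i j ∧ not (edgeᵇ x i j) }) (allEdges n)

-- A saturated (= maximal in [u,v]) chain u = x₀ ⋖ x₁ ⋖ ⋯ ⋖ x_m = v is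
-- given by the list [x₁, …, x_m].
IsMaxChain : ∀ {n} → Vec Sign n → Net n → List (Net n) → Net n → Set
IsMaxChain ε u []       v = u ≡ v
IsMaxChain ε u (w ∷ ws) v = Covers ε u w × IsMaxChain ε w ws v

_≤[_]_ : ∀ {n} → Net n → Vec Sign n → Net n → Set
u ≤[ ε ] v = ∃ λ ws → IsMaxChain ε u ws v

-- λ(x, y) = E(y) \ E(x)  (a single edge when y covers x)
λE : ∀ {n} → Net n → Net n → List (Edge n)
λE x y = diffE x y

chainLabels : ∀ {n} → Net n → List (Net n) → List (Edge n)
chainLabels u []       = []
chainLabels u (w ∷ ws) = λE u w ++ chainLabels w ws

data Increasing {n} : List (Edge n) → Set where
  []  : Increasing []
  [_] : ∀ e → Increasing (e ∷ [])
  _∷_ : ∀ {e f es} → e ≤E f → Increasing (f ∷ es) → Increasing (e ∷ f ∷ es)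

LexLess : ∀ {n} → List (Edge n) → List (Edge n) → Set
LexLess = Lex-< _≡_ _<E_

IsELLabeling : ∀ {n} → Vec Sign n → Net n → Net n → Set
IsELLabeling ε x y =
  ∀ u v → InN ε u → InN ε v → x ≤[ ε ] u → u ≤[ ε ] v → v ≤[ ε ] y →
  Σ (List _) λ c → IsMaxChain ε u c v × Increasing (chainLabels u c) ×
     (∀ c' → IsMaxChain ε u c' v → Increasing (chainLabels u c') → c' ≡ c) ×
     (∀ c' → IsMaxChain ε u c' v → ¬ (c' ≡ c) →
        LexLess (chainLabels u c) (chainLabels u c'))

-- snelling: an EL-labeling such that along every maximal chain of [x, y]
-- the labels, identified with [m] via the order on edges (i.e. with the
-- increasingly sorted list of E(y) \ E(x)), form a permutation of [m].
IsSnelling : ∀ {n} → Vec Sign n → Net n → Net n → Set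
IsSnelling ε x y =
  IsELLabeling ε x y ×
  (∀ c → IsMaxChain ε x c y → chainLabels x c ↭ diffE x y)

{-# OPTIONS --safe #-}
module Submission where

-- Every cover adds exactly one edge, so the labels of a maximal chain from u to v list
-- E(v) \ E(u) without repetition: they are a permutation of it. Conversely, adding to u the
-- least edge of E(v) \ E(u) preserves the sign conditions and, by that minimality, condition B1;
-- so adding the edges of E(v) \ E(u) in increasing order is a maximal chain. A set has only one
-- increasing arrangement and it is lexicographically first among all arrangements, hence this
-- chain is the unique increasing one and precedes every other maximal chain.

open import Defs
open import Data.Nat using (ℕ)
open import Data.Vec using (Vec)

open import Data.Nat using (suc; _+_; _≤_; z≤n; s≤s)
import Data.Nat.Properties as ℕₚ
open import Data.Bool using (Bool; true; false; T; _∧_; not)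
import Data.Bool.Properties as Boolₚ
open import Data.Fin using (Fin; zero; suc; _<_)
import Data.Fin.Properties as Finₚ
open import Data.Vec using ([]; _∷_; lookup; _[_]%=_; _[_]≔_)
import Data.Vec.Properties as Vecₚ
open import Data.List using (List; []; _∷_; _++_; map; reverse; allFin)
import Data.List.Properties as Listₚ
open import Data.List.Relation.Unary.All as All using (All; []; _∷_)
import Data.List.Relation.Unary.All.Properties as Allₚ
open import Data.List.Relation.Unary.AllPairs as AllPairs using (AllPairs; []; _∷_)
import Data.List.Relation.Unary.AllPairs.Properties as AllPairsₚ
open import Data.List.Relation.Unary.Any using (here; there)
import Data.List.Relation.Unary.Any.Properties as Anyₚ
open import Data.List.Relation.Unary.Unique.Propositional using (Unique)
open import Data.List.Membership.Propositional using (_∈_)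
open import Data.List.Membership.Propositional.Properties
  using (∈-allFin; ∈-map⁺; ∈-concat⁺′; ∈-filter⁺; ∈-filter⁻)
open import Data.List.Membership.Propositional.Properties.WithK using (unique∧set⇒bag)
open import Data.List.Relation.Binary.BagAndSetEquality using (∼bag⇒↭)
open import Data.List.Relation.Binary.Permutation.Propositional
  using (_↭_; ↭-refl; ↭-sym; ↭-prep; module PermutationReasoning)
open import Data.List.Relation.Binary.Permutation.Propositional.Properties
  using (∈-resp-↭; drop-∷; ¬x∷xs↭[]; ↭-singleton-inv)
open import Data.List.Relation.Binary.Lex.Core using (this; next)
open import Data.Product using (Σ; ∃; _×_; _,_; proj₁; proj₂)
import Data.Product.Properties as Productₚ
open import Data.Sum using (_⊎_; inj₁; inj₂)
open import Data.Empty using (⊥-elim)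
open import Function using (_∘_; flip; case_of_)
open import Function.Bundles using (mk⇔)
open import Relation.Nullary using (¬_; Dec; yes; no; contradiction)
open import Relation.Nullary.Decidable using (T?)
open import Relation.Binary.PropositionalEquality
  using (_≡_; _≢_; refl; sym; trans; cong; cong₂; subst; subst₂)

private variable
  n : ℕ
  e f g : Edge n
  i j a b : Fin n
  u v x y : Net n

AllPairs-reverse⁺ : ∀ {A : Set} {R : A → A → Set} {xs : List A} →
                    AllPairs R xs → AllPairs (flip R) (reverse xs)
AllPairs-reverse⁺ {xs = []}     []          = []
AllPairs-reverse⁺ {R = R} {xs = x ∷ xs} (x<xs ∷ xs<) =
  subst (AllPairs (flip R)) (sym (Listₚ.unfold-reverse x xs))
    (AllPairsₚ.++⁺ (AllPairs-reverse⁺ xs<) ([] ∷ [])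
      (All.tabulate λ y∈ → All.lookup x<xs (Anyₚ.reverse⁻ y∈) ∷ []))

unique-sameElements⇒↭ : ∀ {A : Set} {xs ys : List A} → Unique xs → Unique ys →
                        (∀ {z} → z ∈ xs → z ∈ ys) → (∀ {z} → z ∈ ys → z ∈ xs) → xs ↭ ys
unique-sameElements⇒↭ xs! ys! to from = ∼bag⇒↭ (unique∧set⇒bag xs! ys! (mk⇔ to from))

_∈E_ : Edge n → Net n → Set
e ∈E x = HasEdge x (proj₁ e) (proj₂ e)

_∉E_ : Edge n → Net n → Set
e ∉E x = edgeᵇ x (proj₁ e) (proj₂ e) ≡ false

<E-irrefl : ¬ e <E e
<E-irrefl (byHead j<j) = Finₚ.<-irrefl refl j<j
<E-irrefl (byTail i<i) = Finₚ.<-irrefl refl i<i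

<E-asym : e <E f → ¬ f <E e
<E-asym (byHead j<l) (byHead l<j) = Finₚ.<-asym j<l l<j
<E-asym (byHead j<j) (byTail _)   = Finₚ.<-irrefl refl j<j
<E-asym (byTail _)   (byHead j<j) = Finₚ.<-irrefl refl j<j
<E-asym (byTail k<i) (byTail i<k) = Finₚ.<-asym k<i i<k

<E-trans : e <E f → f <E g → e <E g
<E-trans (byHead j<l) (byHead l<m) = byHead (Finₚ.<-trans j<l l<m)
<E-trans (byHead j<l) (byTail _)   = byHead j<l
<E-trans (byTail _)   (byHead j<l) = byHead j<l
<E-trans (byTail k<i) (byTail m<k) = byTail (Finₚ.<-trans m<k k<i)

≤E-<E-trans : e ≤E f → f <E g → e <E g
≤E-<E-trans (inj₁ refl) f<g = f<g
≤E-<E-trans (inj₂ e<f)  f<g = <E-trans e<f f<g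

≤E-trans : e ≤E f → f ≤E g → e ≤E g
≤E-trans e≤f (inj₁ refl) = e≤f
≤E-trans e≤f (inj₂ f<g)  = inj₂ (≤E-<E-trans e≤f f<g)

≤E-antisym : e ≤E f → f ≤E e → e ≡ f
≤E-antisym (inj₁ e≡f) _           = e≡f
≤E-antisym (inj₂ _)   (inj₁ f≡e)  = sym f≡e
≤E-antisym (inj₂ e<f) (inj₂ f<e)  = ⊥-elim (<E-asym e<f f<e)

<E⇒≢ : e <E f → e ≢ f
<E⇒≢ e<e refl = <E-irrefl e<e

_≟E_ : (e f : Edge n) → Dec (e ≡ f)
_≟E_ = Productₚ.≡-dec Finₚ._≟_ Finₚ._≟_

increasing-head-≤E : ∀ {d ds} → Increasing (d ∷ ds) → e ∈ d ∷ ds → d ≤E e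
increasing-head-≤E _             (here refl) = inj₁ refl
increasing-head-≤E (d≤d′ ∷ rest) (there e∈) = ≤E-trans d≤d′ (increasing-head-≤E rest e∈)

increasing-tail : ∀ {d ds} → Increasing {n} (d ∷ ds) → Increasing ds
increasing-tail [ _ ]    = []
increasing-tail (_ ∷ ds) = ds

sorted⇒increasing : ∀ {es} → AllPairs (_<E_ {n}) es → Increasing es
sorted⇒increasing []                         = []
sorted⇒increasing (_ ∷ [])                   = [ _ ]
sorted⇒increasing ((e<f ∷ _) ∷ rest@(_ ∷ _)) = inj₂ e<f ∷ sorted⇒increasing rest

increasing-↭⇒≡ : ∀ {es fs : List (Edge n)} → Increasing es → Increasing fs → es ↭ fs → es ≡ fs
increasing-↭⇒≡ {es = []}    {[]}    _ _ _ = refl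
increasing-↭⇒≡ {es = []}    {_ ∷ _} _ _ p = contradiction (↭-sym p) ¬x∷xs↭[]
increasing-↭⇒≡ {es = _ ∷ _} {[]}    _ _ p = contradiction p ¬x∷xs↭[]
increasing-↭⇒≡ {es = e ∷ _} {f ∷ _} es↗ fs↗ p
  with ≤E-antisym (increasing-head-≤E es↗ (∈-resp-↭ (↭-sym p) (here refl)))
                  (increasing-head-≤E fs↗ (∈-resp-↭ p (here refl)))
... | refl = cong (e ∷_) (increasing-↭⇒≡ (increasing-tail es↗) (increasing-tail fs↗) (drop-∷ p))

increasing-lex-least : ∀ {ds ls : List (Edge n)} → Increasing ds → ls ↭ ds → ls ≢ ds → LexLess ds ls
increasing-lex-least {ds = []}    {[]}    _   _ ls≢ds = contradiction refl ls≢ds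
increasing-lex-least {ds = []}    {_ ∷ _} _   p _     = contradiction p ¬x∷xs↭[]
increasing-lex-least {ds = _ ∷ _} {[]}    _   p _     = contradiction (↭-sym p) ¬x∷xs↭[]
increasing-lex-least {ds = d ∷ _} {l ∷ _} ds↗ p ls≢ds with l ≟E d
... | yes refl =
  next refl (increasing-lex-least (increasing-tail ds↗) (drop-∷ p) (ls≢ds ∘ cong (l ∷_)))
... | no l≢d   with increasing-head-≤E ds↗ (∈-resp-↭ p (here refl))
...   | inj₁ d≡l = contradiction (sym d≡l) l≢d
...   | inj₂ d<l = this d<l

column : Fin n → List (Edge n)
column {n} j = map (λ i → (i , j)) (reverse (allFin n))

allEdges-complete : (e : Edge n) → e ∈ allEdges n
allEdges-complete (i , j) =
  ∈-concat⁺′ (∈-map⁺ (λ i → (i , j)) (Anyₚ.reverse⁺ (∈-allFin i))) (∈-map⁺ column (∈-allFin j))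

allEdges-sorted : ∀ n → AllPairs _<E_ (allEdges n)
allEdges-sorted n = AllPairsₚ.concat⁺ (Allₚ.map⁺ (All.universal column-sorted _))
                                      (AllPairsₚ.map⁺ (AllPairs.map columns-ordered allFin-sorted))
  where
  allFin-sorted : AllPairs _<_ (allFin n)
  allFin-sorted = AllPairsₚ.tabulate⁺-< (λ i<j → i<j)
  column-sorted : ∀ j → AllPairs _<E_ (column j)
  column-sorted _ = AllPairsₚ.map⁺ (AllPairs.map byTail (AllPairs-reverse⁺ allFin-sorted))
  columns-ordered : ∀ {j l} → j < l → All (λ e → All (e <E_) (column l)) (column j)
  columns-ordered j<l =
    Allₚ.map⁺ (All.universal (λ _ → Allₚ.map⁺ (All.universal (λ _ → byHead j<l) _)) _)

∈-diffE⁻ : (x y : Net n) → e ∈ diffE x y → e ∈E y × e ∉E x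
∈-diffE⁻ {e = i , j} x y e∈
  with edgeᵇ y i j | edgeᵇ x i j | proj₂ (∈-filter⁻ (T? ∘ _) {xs = allEdges _} e∈)
... | true | false | _ = refl , refl

∈-diffE⁺ : (x y : Net n) → e ∈E y → e ∉E x → e ∈ diffE x y
∈-diffE⁺ {e = e} x y e∈y e∉x =
  ∈-filter⁺ (T? ∘ _) (allEdges-complete e) (subst₂ (λ p q → T (p ∧ not q)) (sym e∈y) (sym e∉x) _)

diffE-sorted : (x y : Net n) → AllPairs _<E_ (diffE x y)
diffE-sorted x y = AllPairsₚ.filter⁺ (T? ∘ _) (allEdges-sorted _)

diffE-increasing : (x y : Net n) → Increasing (diffE x y)
diffE-increasing x y = sorted⇒increasing (diffE-sorted x y)

diffE-unique : (x y : Net n) → Unique (diffE x y)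
diffE-unique x y = AllPairs.map <E⇒≢ (diffE-sorted x y)

diffE-self : (x : Net n) → diffE x x ≡ []
diffE-self x = Listₚ.filter-none (T? ∘ _) {xs = allEdges _}
  (All.universal (λ (i , j) → subst T (Boolₚ.∧-inverseʳ (edgeᵇ x i j))) _)

missing-or-⊆E : (x y : Net n) → (∃ λ e → e ∈E y × e ∉E x) ⊎ y ⊆E x
missing-or-⊆E x y with diffE x y in eq
... | e ∷ _ = inj₁ (e , ∈-diffE⁻ x y (subst (e ∈_) (sym eq) (here refl)))
... | []    = inj₂ y⊆x
  where
  y⊆x : y ⊆E x
  y⊆x i j ij∈y with edgeᵇ x i j in ij∉x
  ... | true  = refl
  ... | false = case subst ((i , j) ∈_) eq (∈-diffE⁺ x y ij∈y ij∉x) of λ ()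

addE : Net n → Edge n → Net n
addE u (a , b) = u [ a ]%= (_[ b ]≔ true)

module _ (u : Net n) (a b : Fin n) where

  addE-∋ : (a , b) ∈E addE u (a , b)
  addE-∋ = trans (cong (λ row → lookup row b) (Vecₚ.lookup∘updateAt a u))
                 (Vecₚ.lookup∘update b (lookup u a) true)

  edgeᵇ-addE-≢ : (i , j) ≢ (a , b) → edgeᵇ (addE u (a , b)) i j ≡ edgeᵇ u i j
  edgeᵇ-addE-≢ {i = i} {j} ij≢ab with i Finₚ.≟ a
  ... | no i≢a   = cong (λ row → lookup row j) (Vecₚ.lookup∘updateAt′ i a i≢a u)
  ... | yes refl = trans (cong (λ row → lookup row j) (Vecₚ.lookup∘updateAt i u))
                         (Vecₚ.lookup∘update′ (ij≢ab ∘ cong (i ,_)) (lookup u i) true)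

  addE-⊇ : u ⊆E addE u (a , b)
  addE-⊇ i j ij∈u with (i , j) ≟E (a , b)
  ... | yes refl = addE-∋
  ... | no ij≢ab = trans (edgeᵇ-addE-≢ ij≢ab) ij∈u

  addE-∈⁻ : ∀ i j → (i , j) ∈E addE u (a , b) → (i , j) ∈E u ⊎ (i , j) ≡ (a , b)
  addE-∈⁻ i j ij∈ with (i , j) ≟E (a , b)
  ... | yes ij≡ab = inj₂ ij≡ab
  ... | no ij≢ab  = inj₁ (trans (sym (edgeᵇ-addE-≢ ij≢ab)) ij∈)

  addE-∉ : ∀ i j → (i , j) ∉E addE u (a , b) → (i , j) ∉E u
  addE-∉ i j ij∉ = trans (sym (edgeᵇ-addE-≢ ij≢ab)) ij∉
    where
    ij≢ab : (i , j) ≢ (a , b)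
    ij≢ab refl = case trans (sym addE-∋) ij∉ of λ ()

  addE-⊆ : (v : Net n) → u ⊆E v → (a , b) ∈E v → addE u (a , b) ⊆E v
  addE-⊆ v u⊆v ab∈v i j ij∈ with addE-∈⁻ i j ij∈
  ... | inj₁ ij∈u = u⊆v i j ij∈u
  ... | inj₂ refl = ab∈v

  diffE-addE-↭ : (v : Net n) → (a , b) ∉E u → (a , b) ∈E v →
                 diffE u v ↭ (a , b) ∷ diffE (addE u (a , b)) v
  diffE-addE-↭ v ab∉u ab∈v =
    unique-sameElements⇒↭ (diffE-unique u v) (All.tabulate ab≢ ∷ diffE-unique u⁺ v) to from
    where
    u⁺ : Net _
    u⁺ = addE u (a , b)
    ab≢ : e ∈ diffE u⁺ v → (a , b) ≢ e
    ab≢ e∈ refl = case trans (sym addE-∋) (proj₂ (∈-diffE⁻ u⁺ v e∈)) of λ ()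
    to : e ∈ diffE u v → e ∈ (a , b) ∷ diffE u⁺ v
    to {e = i , j} e∈ with (i , j) ≟E (a , b) | ∈-diffE⁻ u v e∈
    ... | yes e≡ab | _         = here e≡ab
    ... | no e≢ab  | e∈v , e∉u = there (∈-diffE⁺ u⁺ v e∈v (trans (edgeᵇ-addE-≢ e≢ab) e∉u))
    from : e ∈ (a , b) ∷ diffE u⁺ v → e ∈ diffE u v
    from (here refl) = ∈-diffE⁺ u v ab∈v ab∉u
    from {e = i , j} (there e∈) with ∈-diffE⁻ u⁺ v e∈
    ... | e∈v , e∉u⁺ = ∈-diffE⁺ u v e∈v (addE-∉ i j e∉u⁺)

  λE-addE : (a , b) ∉E u → λE u (addE u (a , b)) ≡ (a , b) ∷ []
  λE-addE ab∉u = ↭-singleton-inv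
    (subst (λ rest → λE u u⁺ ↭ (a , b) ∷ rest) (diffE-self u⁺) (diffE-addE-↭ u⁺ ab∉u addE-∋))
    where
    u⁺ : Net _
    u⁺ = addE u (a , b)

countTrue-set : ∀ {m} (r : Vec Bool m) (b : Fin m) → lookup r b ≡ false →
                countTrue (r [ b ]≔ true) ≡ suc (countTrue r)
countTrue-set (false ∷ r) zero    refl = refl
countTrue-set (true ∷ r)  (suc b) rb   = cong suc (countTrue-set r b rb)
countTrue-set (false ∷ r) (suc b) rb   = countTrue-set r b rb

sumℕ-vmap-updateAt : ∀ {A : Set} {k} (g : A → ℕ) (xs : Vec A k) (a : Fin k) {h : A → A} →
                     g (h (lookup xs a)) ≡ suc (g (lookup xs a)) →
                     sumℕ (vmap g (xs [ a ]%= h)) ≡ suc (sumℕ (vmap g xs))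
sumℕ-vmap-updateAt g (x ∷ xs) zero    gh = cong (_+ sumℕ (vmap g xs)) gh
sumℕ-vmap-updateAt g (x ∷ xs) (suc a) gh =
  trans (cong (g x +_) (sumℕ-vmap-updateAt g xs a gh)) (ℕₚ.+-suc (g x) _)

ρ-addE : (u : Net n) (a b : Fin n) → (a , b) ∉E u → ρ (addE u (a , b)) ≡ suc (ρ u)
ρ-addE u a b ab∉u = sumℕ-vmap-updateAt countTrue u a (countTrue-set (lookup u a) b ab∉u)

countTrue-mono : ∀ {m} (r s : Vec Bool m) → (∀ j → lookup r j ≡ true → lookup s j ≡ true) →
                 countTrue r ≤ countTrue s
countTrue-mono []          []          _   = z≤n
countTrue-mono (true ∷ r)  (s₀ ∷ s)    r⊆s with refl ← r⊆s zero refl =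
  s≤s (countTrue-mono r s (r⊆s ∘ suc))
countTrue-mono (false ∷ r) (true ∷ s)  r⊆s = ℕₚ.m≤n⇒m≤1+n (countTrue-mono r s (r⊆s ∘ suc))
countTrue-mono (false ∷ r) (false ∷ s) r⊆s = countTrue-mono r s (r⊆s ∘ suc)

ρ-mono : (x y : Net n) → x ⊆E y → ρ x ≤ ρ y
ρ-mono x y = rows x y
  where
  rows : ∀ {k m} (xs ys : Vec (Vec Bool m) k) →
         (∀ i j → lookup (lookup xs i) j ≡ true → lookup (lookup ys i) j ≡ true) →
         sumℕ (vmap countTrue xs) ≤ sumℕ (vmap countTrue ys)
  rows []       []       _     = z≤n
  rows (r ∷ xs) (s ∷ ys) xs⊆ys =
    ℕₚ.+-mono-≤ (countTrue-mono r s (xs⊆ys zero)) (rows xs ys (xs⊆ys ∘ suc))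

lookup-ext : ∀ {A : Set} {k} (xs ys : Vec A k) → (∀ i → lookup xs i ≡ lookup ys i) → xs ≡ ys
lookup-ext xs ys eq =
  trans (sym (Vecₚ.tabulate∘lookup xs)) (trans (Vecₚ.tabulate-cong eq) (Vecₚ.tabulate∘lookup ys))

⊆E-antisym : (x y : Net n) → x ⊆E y → y ⊆E x → x ≡ y
⊆E-antisym x y x⊆y y⊆x =
  lookup-ext x y λ i → lookup-ext (lookup x i) (lookup y i) λ j → ≡true⇔⇒≡ (x⊆y i j) (y⊆x i j)
  where
  ≡true⇔⇒≡ : ∀ {p q} → (p ≡ true → q ≡ true) → (q ≡ true → p ≡ true) → p ≡ q
  ≡true⇔⇒≡ {true}           p⇒q _   = sym (p⇒q refl)
  ≡true⇔⇒≡ {false} {true}  _   q⇒p = q⇒p refl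
  ≡true⇔⇒≡ {false} {false} _   _   = refl

⊆E∧ρ≤⇒≡ : (x y : Net n) → x ⊆E y → ρ y ≤ ρ x → x ≡ y
⊆E∧ρ≤⇒≡ x y x⊆y ρy≤ρx with missing-or-⊆E x y
... | inj₂ y⊆x = ⊆E-antisym x y x⊆y y⊆x
... | inj₁ ((a , b) , ab∈y , ab∉x) = contradiction ρy≤ρx (ℕₚ.<⇒≱ (begin-strict
      ρ x                  <⟨ ℕₚ.n<1+n (ρ x) ⟩
      suc (ρ x)            ≡⟨ ρ-addE x a b ab∉x ⟨
      ρ (addE x (a , b))   ≤⟨ ρ-mono (addE x (a , b)) y (addE-⊆ x a b y x⊆y ab∈y) ⟩
      ρ y                  ∎))
  where open ℕₚ.≤-Reasoning

⊆E∧ρ≡1+ρ⇒addE : (u w : Net n) → u ⊆E w → ρ w ≡ suc (ρ u) →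
                 Σ (Edge n) λ e → e ∉E u × w ≡ addE u e
⊆E∧ρ≡1+ρ⇒addE u w u⊆w ρw≡1+ρu with missing-or-⊆E u w
... | inj₂ w⊆u = contradiction (subst (_≤ ρ u) ρw≡1+ρu (ρ-mono w u w⊆u)) ℕₚ.1+n≰n
... | inj₁ ((a , b) , ab∈w , ab∉u) =
  (a , b) , ab∉u , sym (⊆E∧ρ≤⇒≡ (addE u (a , b)) w (addE-⊆ u a b w u⊆w ab∈w)
                                 (ℕₚ.≤-reflexive (trans ρw≡1+ρu (sym (ρ-addE u a b ab∉u)))))

tail-isSource : (v : Net n) → IsNetwork v → HasEdge v a b → IsSource v a
tail-isSource {b = b} v v-net ab∈v with IsNetwork.kind v-net _
... | inj₁ source               = source
... | inj₂ (inj₁ (_ , no-out))  = contradiction ab∈v (no-out b)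
... | inj₂ (inj₂ (no-out , _))  = contradiction ab∈v (no-out b)

head-isSink : (v : Net n) → IsNetwork v → HasEdge v a b → IsSink v b
head-isSink {a = a} v v-net ab∈v with IsNetwork.kind v-net _
... | inj₁ (_ , no-in)          = contradiction ab∈v (no-in a)
... | inj₂ (inj₁ sink)          = sink
... | inj₂ (inj₂ (_ , no-in))   = contradiction ab∈v (no-in a)

IsSource-⊆E : (w v : Net n) → w ⊆E v → IsSource v a → HasEdge w a b → IsSource w a
IsSource-⊆E w v w⊆v (_ , no-in) ab∈w = (_ , ab∈w) , λ k ka∈w → no-in k (w⊆v k _ ka∈w)

IsSink-⊆E : (w v : Net n) → w ⊆E v → IsSink v b → HasEdge w a b → IsSink w b
IsSink-⊆E w v w⊆v (_ , no-out) ab∈w = (_ , ab∈w) , λ j bj∈w → no-out j (w⊆v _ j bj∈w)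

source-sign : ∀ {p s} → IsSource x p → SignOK x p s → s ≡ pos
source-sign {s = pos} _                 _                      = refl
source-sign {s = zer} ((j , pj∈x) , _)  (no-out , _)           = contradiction pj∈x (no-out j)
source-sign {s = neg} ((j , pj∈x) , _)  (inj₁ (_ , no-out))    = contradiction pj∈x (no-out j)
source-sign {s = neg} ((j , pj∈x) , _)  (inj₂ (no-out , _))    = contradiction pj∈x (no-out j)

sink-sign : ∀ {p s} → IsSink x p → SignOK x p s → s ≡ neg
sink-sign {s = neg} _                 _                      = refl
sink-sign {s = zer} ((k , kp∈x) , _)  (_ , no-in)            = contradiction kp∈x (no-in k)
sink-sign {s = pos} ((k , kp∈x) , _)  (inj₁ (_ , no-in))     = contradiction kp∈x (no-in k)
sink-sign {s = pos} ((k , kp∈x) , _)  (inj₂ (_ , no-in))     = contradiction kp∈x (no-in k)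

module SameIncidence (x y : Net n) (p : Fin n)
  (out≡ : ∀ j → edgeᵇ y p j ≡ edgeᵇ x p j) (in≡ : ∀ k → edgeᵇ y k p ≡ edgeᵇ x k p) where

  private
    out⇒ : ∀ j → HasEdge y p j → HasEdge x p j
    out⇒ j = trans (sym (out≡ j))
    in⇒ : ∀ k → HasEdge y k p → HasEdge x k p
    in⇒ k = trans (sym (in≡ k))

  source : IsSource x p → IsSource y p
  source ((j , pj∈x) , no-in) = (j , trans (out≡ j) pj∈x) , λ k → no-in k ∘ in⇒ k

  sink : IsSink x p → IsSink y p
  sink ((k , kp∈x) , no-out) = (k , trans (in≡ k) kp∈x) , λ j → no-out j ∘ out⇒ j

  neutral : IsNeutral x p → IsNeutral y p
  neutral (no-out , no-in) = (λ j → no-out j ∘ out⇒ j) , (λ k → no-in k ∘ in⇒ k)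

  kind : IsSource x p ⊎ IsSink x p ⊎ IsNeutral x p → IsSource y p ⊎ IsSink y p ⊎ IsNeutral y p
  kind (inj₁ src)        = inj₁ (source src)
  kind (inj₂ (inj₁ snk)) = inj₂ (inj₁ (sink snk))
  kind (inj₂ (inj₂ neu)) = inj₂ (inj₂ (neutral neu))

  signOK : ∀ s → SignOK x p s → SignOK y p s
  signOK pos (inj₁ src) = inj₁ (source src)
  signOK pos (inj₂ neu) = inj₂ (neutral neu)
  signOK neg (inj₁ snk) = inj₁ (sink snk)
  signOK neg (inj₂ neu) = inj₂ (neutral neu)
  signOK zer neu        = neutral neu

module _ (ε : Vec Sign n) {u v : Net n} (u∈N : InN ε u) (v∈N : InN ε v) (u⊆v : u ⊆E v)
         {a b : Fin n} (ab∈v : (a , b) ∈E v) (ab∉u : (a , b) ∉E u)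
         (ab-least : ∀ {e} → e ∈ diffE u v → (a , b) ≤E e) where

  private
    u⁺ : Net n
    u⁺ = addE u (a , b)
    u⁺⊆v : u⁺ ⊆E v
    u⁺⊆v = addE-⊆ u a b v u⊆v ab∈v
    module U = IsNetwork (proj₁ u∈N)
    module V = IsNetwork (proj₁ v∈N)
    a-source-v : IsSource v a
    a-source-v = tail-isSource v (proj₁ v∈N) ab∈v
    b-sink-v : IsSink v b
    b-sink-v = head-isSink v (proj₁ v∈N) ab∈v
    a-source : IsSource u⁺ a
    a-source = IsSource-⊆E u⁺ v u⁺⊆v a-source-v (addE-∋ u a b)
    b-sink : IsSink u⁺ b
    b-sink = IsSink-⊆E u⁺ v u⁺⊆v b-sink-v (addE-∋ u a b)
    module Away (p : Fin n) (p≢a : p ≢ a) (p≢b : p ≢ b) = SameIncidence u u⁺ p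
      (λ j → edgeᵇ-addE-≢ u a b (p≢a ∘ cong proj₁))
      (λ k → edgeᵇ-addE-≢ u a b (p≢b ∘ cong proj₂))

  addE-least-forward : ∀ i j → HasEdge u⁺ i j → i < j
  addE-least-forward i j ij∈u⁺ with addE-∈⁻ u a b i j ij∈u⁺
  ... | inj₁ ij∈u = U.forward i j ij∈u
  ... | inj₂ refl = V.forward a b ab∈v

  addE-least-kind : ∀ p → IsSource u⁺ p ⊎ IsSink u⁺ p ⊎ IsNeutral u⁺ p
  addE-least-kind p with p Finₚ.≟ a | p Finₚ.≟ b
  ... | yes refl | _        = inj₁ a-source
  ... | no _     | yes refl = inj₂ (inj₁ b-sink)
  ... | no p≢a   | no p≢b   = Away.kind p p≢a p≢b (U.kind p)

  -- Were (j,k) missing from u, B1 in v would put it in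
  -- E(v) \ E(u), above (a,b); then (i,k) and (j,l) are not (a,b), so they lie in u, and B1 in u
  -- puts (j,k) in u after all.
  addE-least-B1 : ∀ i j k l → i < j → j < k → k < l →
                  HasEdge u⁺ i k → HasEdge u⁺ j l → HasEdge u⁺ j k
  addE-least-B1 i j k l i<j j<k k<l ik∈u⁺ jl∈u⁺ with edgeᵇ u j k in u-jk
  ... | true  = addE-⊇ u a b j k u-jk
  ... | false = case trans (sym jk∈u) u-jk of λ ()
    where
    ab≤jk : (a , b) ≤E (j , k)
    ab≤jk = ab-least
      (∈-diffE⁺ u v (V.B1 i j k l i<j j<k k<l (u⁺⊆v i k ik∈u⁺) (u⁺⊆v j l jl∈u⁺)) u-jk)
    old : ∀ {i′ j′} → HasEdge u⁺ i′ j′ → (j , k) <E (i′ , j′) → HasEdge u i′ j′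
    old {i′} {j′} e∈u⁺ jk<e with addE-∈⁻ u a b i′ j′ e∈u⁺
    ... | inj₁ e∈u  = e∈u
    ... | inj₂ refl = contradiction (≤E-<E-trans ab≤jk jk<e) <E-irrefl
    jk∈u : HasEdge u j k
    jk∈u = U.B1 i j k l i<j j<k k<l (old ik∈u⁺ (byTail i<j)) (old jl∈u⁺ (byHead k<l))

  addE-least-signOK : ∀ p → SignOK u⁺ p (lookup ε p)
  addE-least-signOK p with p Finₚ.≟ a | p Finₚ.≟ b
  ... | yes refl | _        =
    subst (SignOK u⁺ p) (sym (source-sign a-source-v (proj₂ v∈N p))) (inj₁ a-source)
  ... | no _     | yes refl =
    subst (SignOK u⁺ p) (sym (sink-sign b-sink-v (proj₂ v∈N p))) (inj₁ b-sink)
  ... | no p≢a   | no p≢b   = Away.signOK p p≢a p≢b _ (proj₂ u∈N p)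

  addE-least-InN : InN ε u⁺
  addE-least-InN =
    record { forward = addE-least-forward ; kind = addE-least-kind ; B1 = addE-least-B1 } ,
    addE-least-signOK

addEdges : Net n → List (Edge n) → List (Net n)
addEdges u []       = []
addEdges u (e ∷ es) = addE u e ∷ addEdges (addE u e) es

module _ (ε : Vec Sign n) where

  maxChain-⊆E : ∀ {u v} c → IsMaxChain ε u c v → u ⊆E v
  maxChain-⊆E []       refl                      i j ij∈u = ij∈u
  maxChain-⊆E (w ∷ ws) ((_ , _ , _ , u⊆w) , w⋯v) i j ij∈u = maxChain-⊆E ws w⋯v i j (u⊆w i j ij∈u)

  maxChain≡addEdges : ∀ {u v} c → IsMaxChain ε u c v → c ≡ addEdges u (chainLabels u c)
  maxChain≡addEdges             []       _           = refl
  maxChain≡addEdges {u = u} (w ∷ ws) ((_ , _ , ρw≡ , u⊆w) , w⋯v) with ⊆E∧ρ≡1+ρ⇒addE u w u⊆w ρw≡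
  ... | (a , b) , ab∉u , refl rewrite λE-addE u a b ab∉u =
    cong (addE u (a , b) ∷_) (maxChain≡addEdges ws w⋯v)

  maxChain-labels-↭ : ∀ {u v} c → IsMaxChain ε u c v → chainLabels u c ↭ diffE u v
  maxChain-labels-↭ {u = u}     []       refl        = subst ([] ↭_) (sym (diffE-self u)) ↭-refl
  maxChain-labels-↭ {u = u} {v} (w ∷ ws) ((_ , _ , ρw≡ , u⊆w) , w⋯v) with ⊆E∧ρ≡1+ρ⇒addE u w u⊆w ρw≡
  ... | (a , b) , ab∉u , refl = begin
    λE u u⁺ ++ chainLabels u⁺ ws  ≡⟨ cong (_++ chainLabels u⁺ ws) (λE-addE u a b ab∉u) ⟩
    (a , b) ∷ chainLabels u⁺ ws   ↭⟨ ↭-prep _ (maxChain-labels-↭ ws w⋯v) ⟩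
    (a , b) ∷ diffE u⁺ v          ↭⟨ diffE-addE-↭ u a b v ab∉u ab∈v ⟨
    diffE u v                     ∎
    where
    open PermutationReasoning
    u⁺ : Net n
    u⁺ = addE u (a , b)
    ab∈v : (a , b) ∈E v
    ab∈v = maxChain-⊆E ws w⋯v a b (addE-∋ u a b)

  increasingChain : ∀ {u v} ds → diffE u v ≡ ds → InN ε u → InN ε v → u ⊆E v →
                    IsMaxChain ε u (addEdges u ds) v × chainLabels u (addEdges u ds) ≡ ds
  increasingChain {u} {v} [] diff≡[] _ _ u⊆v with missing-or-⊆E u v
  ... | inj₂ v⊆u              = ⊆E-antisym u v u⊆v v⊆u , refl
  ... | inj₁ (e , e∈v , e∉u)  = case subst (e ∈_) diff≡[] (∈-diffE⁺ u v e∈v e∉u) of λ ()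
  increasingChain {u} {v} ((a , b) ∷ rest) diff≡ u∈N v∈N u⊆v
    with ∈-diffE⁻ u v (subst ((a , b) ∈_) (sym diff≡) (here refl))
  ... | ab∈v , ab∉u =
    ((u∈N , u⁺∈N , ρ-addE u a b ab∉u , addE-⊇ u a b) , proj₁ rec) ,
    cong₂ _++_ (λE-addE u a b ab∉u) (proj₂ rec)
    where
    diff↗ : Increasing ((a , b) ∷ rest)
    diff↗ = subst Increasing diff≡ (diffE-increasing u v)
    u⁺ : Net n
    u⁺ = addE u (a , b)
    u⁺∈N : InN ε u⁺
    u⁺∈N = addE-least-InN ε u∈N v∈N u⊆v ab∈v ab∉u (increasing-head-≤E diff↗ ∘ subst (_ ∈_) diff≡)
    diff⁺≡rest : diffE u⁺ v ≡ rest
    diff⁺≡rest = increasing-↭⇒≡ (diffE-increasing u⁺ v) (increasing-tail diff↗)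
      (drop-∷ (subst ((a , b) ∷ diffE u⁺ v ↭_) diff≡ (↭-sym (diffE-addE-↭ u a b v ab∉u ab∈v))))
    rec : IsMaxChain ε u⁺ (addEdges u⁺ rest) v × chainLabels u⁺ (addEdges u⁺ rest) ≡ rest
    rec = increasingChain rest diff⁺≡rest u⁺∈N v∈N (addE-⊆ u a b v u⊆v ab∈v)

  lexFirstChain : ∀ {u v} → InN ε u → InN ε v → u ⊆E v →
    Σ (List (Net n)) λ c → IsMaxChain ε u c v × Increasing (chainLabels u c) ×
      (∀ c′ → IsMaxChain ε u c′ v → Increasing (chainLabels u c′) → c′ ≡ c) ×
      (∀ c′ → IsMaxChain ε u c′ v → ¬ (c′ ≡ c) → LexLess (chainLabels u c) (chainLabels u c′))
  lexFirstChain {u} {v} u∈N v∈N u⊆v with increasingChain (diffE u v) refl u∈N v∈N u⊆v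
  ... | c-max , c-labels =
    c , c-max , subst Increasing (sym c-labels) (diffE-increasing u v) , unique , lex-least
    where
    c : List (Net n)
    c = addEdges u (diffE u v)
    labels≡⇒≡c : ∀ c′ → IsMaxChain ε u c′ v → chainLabels u c′ ≡ diffE u v → c′ ≡ c
    labels≡⇒≡c c′ c′-max eq = trans (maxChain≡addEdges c′ c′-max) (cong (addEdges u) eq)
    unique : ∀ c′ → IsMaxChain ε u c′ v → Increasing (chainLabels u c′) → c′ ≡ c
    unique c′ c′-max c′↗ = labels≡⇒≡c c′ c′-max
      (increasing-↭⇒≡ c′↗ (diffE-increasing u v) (maxChain-labels-↭ c′ c′-max))
    lex-least : ∀ c′ → IsMaxChain ε u c′ v → ¬ (c′ ≡ c) →
                LexLess (chainLabels u c) (chainLabels u c′)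
    lex-least c′ c′-max c′≢c = subst (λ ls → LexLess ls (chainLabels u c′)) (sym c-labels)
      (increasing-lex-least (diffE-increasing u v) (maxChain-labels-↭ c′ c′-max)
                            (c′≢c ∘ labels≡⇒≡c c′ c′-max))

lemma5p5 : (n : ℕ) (ε : Vec Sign n) → FirstNonzeroIsOne ε →
           (x y : Net n) → InN ε x → InN ε y → x ≤[ ε ] y →
           IsSnelling ε x y
lemma5p5 n ε _ x y _ _ _ = isEL , maxChain-labels-↭ ε
  where
  isEL : IsELLabeling ε x y
  isEL u v u∈N v∈N _ (c , u⋯v) _ = lexFirstChain ε u∈N v∈N (maxChain-⊆E ε c u⋯v)
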